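{- Let $\Upsilon$ be a gain signed graph, and let $\Upsilon'$ be obtained from $\Upsilon$ by any sign switching, gain switching, and reorientation of edges. Then $M(\Upsilon')=M(\Upsilon)$; consequently a subset of $E$ indexes a linearly dependent family of vectors $\mathbf{z}(e)$ for $\Upsilon$ if and only if it does so for $\Upsilon'$.
   Context: Let $\mathbb{K}$ be a field of characteristic $\ne2$. A graph $\Gamma=(V,E)$ has vertex set $V=\{v_1,\dots,v_n\}$ and finite edge set $E$; edges are links (two ends at distinct vertices), loops (two ends at one vertex), half edges (one end) or loose edges (no ends); parallel edges allowed. A gain signed graph $\Upsilon=(\Gamma,\sigma,\varphi)$: $\sigma:E\to\{\pm1\}$ (half edges negative, loose edges positive); with an orientation $\tau$ (signs $\tau(v,e)\in\{\pm1\}$ on edge ends, $\tau(v,e)\tau(w,e)=-\sigma(e)$ for a link or loop with ends $v,w$) each edge has gain $\varphi(e)\in\mathbb{K}$; reorienting $e$ negates its $\tau$-values and its gain. Neutral = gain $0$. Walk gain of $W=u_0e_1\cdots e_lu_l$: $\varphi(W)=-\sum_i\varphi(e_i)\sigma(W_{0,i-1})\tau(u_{i-1},e_i)$, $\sigma(W_{0,j})=\prod_{i\le j}\sigma(e_i)$. Ultrawalks may begin with a half edge $e_0$ at $u_0$ and/or end with a half edge $e_{l+1}$ at $u_l$; their gain adds $\tau(u_0,e_0)\varphi(e_0)$ and/or $-\varphi(e_{l+1})\sigma(W_{0,l})\tau(u_l,e_{l+1})$ to $\varphi(W_{0,l})$. Circles: connected 2-regular subgraphs, sign = product of edge signs;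 a negative figure is a negative circle or a half edge. A sign circuit is a positive circle, a loose edge, or a handcuff (two negative figures with exactly one common vertex, or two disjoint negative figures plus a path joining them meeting them only at its ends). Its gain: the edge gain for a loose edge; else $\varphi(W)$ for a circuit walk (once around a positive circle; for a handcuff with figures $C_1,C_2$, connecting path $P$ of length $\ge0$: around $C_1$, along $P$, around $C_2$, back along $P$ if both circles; from half edge $C_1$ along $P$, around $C_2$, back, ending with $C_1$ if $C_1$ half edge and $C_2$ circle; from one half edge along $P$ to the other if both half edges); well defined up to sign; neutral if $0$. $S$ is hyperbalanced if all sign circuits in $S$ are neutral, hyperfrustrated otherwise; sign balanced if no negative circle and no half edge. $b_\Sigma(S)$ = number of sign-balanced connected components of $(V,S)$ (loose edges excluded). $M(\Upsilon)$: matroid on $E$ with rank $n-b_\Sigma(S)+\delta(S)$, $\delta=0$ if hyperbalanced, $1$ otherwise. Sign switching by $\zeta:V\to\{\pm1\}$: $\sigma^\zeta(e)=\zeta(v)\sigma(e)\zeta(w)$ for a link or loop with ends $v,w$ (half/loose edges unchanged), $\tau^\zeta(v,e)=\zeta(v)\tau(v,e)$, gains unchanged. Gain switching by $\theta:V\to\mathbb{K}$: $\varphi^\theta(e)=\tau(v,e)\theta(v)+\varphi(e)+\tau(w,e)\theta(w)$ for a link/loop with ends $v,w$, $\tau(v,e)\theta(v)+\varphi(e)$ for a half edge at $v$, unchanged for loose edges. Vectors in $\mathbb{K}^{1+n}$ (basis $\mathbf{e}_0,\dots,\mathbf{e}_n$): $\mathbf{z}(e)=\varphi(e)\mathbf{e}_0+\tau(v_i,e)\mathbf{e}_i+\tau(v_j,e)\mathbf{e}_j$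 for a link or loop with ends $v_i,v_j$ (terms added for a loop), $\varphi(e)\mathbf{e}_0+\tau(v_i,e)\mathbf{e}_i$ for a half edge at $v_i$, $\varphi(e)\mathbf{e}_0$ for a loose edge. -}

module Defs where

open import Level using (_⊔_)
open import Algebra.Bundles using (CommutativeRing)
open import Data.Bool using (Bool; true; false; if_then_else_)
open import Data.Nat using (ℕ; zero; suc; _∸_; _≤_)
open import Data.Fin using (Fin; zero; suc; _≟_)
open import Data.Fin.Subset using (Subset; _∈_; _∉_)
open import Data.Sign using (Sign; opposite) renaming (_*_ to _·_)
open import Data.List using (List; []; _∷_; _++_; length)
open import Data.List.Membership.Propositional using () renaming (_∈_ to _∈ₗ_)
open import Data.List.Relation.Unary.All using (All)
open import Data.List.Relation.Unary.Any using (Any)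
open import Data.List.Relation.Unary.AllPairs using (AllPairs)
open import Data.List.Relation.Unary.Unique.Propositional using (Unique)
open import Data.Product using (Σ; ∃; _×_; _,_)
open import Data.Sum using (_⊎_)
open import Relation.Nullary using (¬_; does)
open import Relation.Binary.PropositionalEquality using (_≡_; _≢_)
open import Relation.Binary.Construct.Closure.ReflexiveTransitive using (Star)

-- Incidence data of an edge of a graph on vertex set Fin n.
--   link a b : a link (a ≢ b) or a loop (a ≡ b); it has a FIRST end at a
--              and a SECOND end at b (the two ends of a loop are distinct
--              ends at the same vertex).
--   half a   : a half edge with its unique end at a.
--   loose    : a loose edge (no ends).

data Ends (n : ℕ) : Set where
  link  : Fin n → Fin n → Ends n
  half  : Fin n → Ends n
  loose : Ends n

module _ {c ℓ} (R : CommutativeRing c ℓ) where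
  open CommutativeRing R using (_≈_; _+_; _*_; -_; 0#; 1#) renaming (Carrier to K)

  IsField : Set (c ⊔ ℓ)
  IsField = (¬ (0# ≈ 1#)) × (∀ x → ¬ (x ≈ 0#) → ∃ λ y → x * y ≈ 1#)

  CharNot2 : Set ℓ
  CharNot2 = ¬ (1# + 1# ≈ 0#)

  ⟦_⟧ : Sign → K
  ⟦ Sign.+ ⟧ = 1#
  ⟦ Sign.- ⟧ = - 1#

  -- A (raw) gain signed graph with orientation:
  --   τ₁ e = τ at the first end of e (the unique end if e is a half edge),
  --   τ₂ e = τ at the second end of e (only meaningful for links/loops).
  -- Values of τ at non-existent ends are never used.
  record GSG (n m : ℕ) : Set c where
    field
      ends : Fin m → Ends n
      σ    : Fin m → Sign
      τ₁   : Fin m → Sign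
      τ₂   : Fin m → Sign
      φ    : Fin m → K

  open GSG public

  WFEdge : ∀ {n m} → GSG n m → Fin m → Ends n → Set
  WFEdge Υ e (link a b) = τ₁ Υ e · τ₂ Υ e ≡ opposite (σ Υ e)
  WFEdge Υ e (half a)   = σ Υ e ≡ Sign.-
  WFEdge Υ e loose      = σ Υ e ≡ Sign.+

  WF : ∀ {n m} → GSG n m → Set
  WF Υ = ∀ e → WFEdge Υ e (ends Υ e)

  signSwitch : ∀ {n m} → (Fin n → Sign) → GSG n m → GSG n m
  signSwitch {n} {m} ζ Υ = record
    { ends = ends Υ ; σ = σ' ; τ₁ = t₁ ; τ₂ = t₂ ; φ = φ Υ }
    where
    σ' : Fin m → Sign
    σ' e with ends Υ e
    ... | link a b = ζ a · σ Υ e · ζ b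
    ... | half a   = σ Υ e
    ... | loose    = σ Υ e
    t₁ : Fin m → Sign
    t₁ e with ends Υ e
    ... | link a b = ζ a · τ₁ Υ e
    ... | half a   = ζ a · τ₁ Υ e
    ... | loose    = τ₁ Υ e
    t₂ : Fin m → Sign
    t₂ e with ends Υ e
    ... | link a b = ζ b · τ₂ Υ e
    ... | half a   = τ₂ Υ e
    ... | loose    = τ₂ Υ e

  gainSwitch : ∀ {n m} → (Fin n → K) → GSG n m → GSG n m
  gainSwitch {n} {m} θ Υ = record
    { ends = ends Υ ; σ = σ Υ ; τ₁ = τ₁ Υ ; τ₂ = τ₂ Υ ; φ = φ' }
    where
    φ' : Fin m → K
    φ' e with ends Υ e
    ... | link a b = ⟦ τ₁ Υ e ⟧ * θ a + φ Υ e + ⟦ τ₂ Υ e ⟧ * θ b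
    ... | half a   = ⟦ τ₁ Υ e ⟧ * θ a + φ Υ e
    ... | loose    = φ Υ e

  reorient : ∀ {n m} → (Fin m → Bool) → GSG n m → GSG n m
  reorient ρ Υ = record
    { ends = ends Υ
    ; σ = σ Υ
    ; τ₁ = λ e → if ρ e then opposite (τ₁ Υ e) else τ₁ Υ e
    ; τ₂ = λ e → if ρ e then opposite (τ₂ Υ e) else τ₂ Υ e
    ; φ  = λ e → if ρ e then - (φ Υ e) else φ Υ e
    }

  data _⟶_ {n m} : GSG n m → GSG n m → Set c where
    sign-switch : ∀ ζ Υ → Υ ⟶ signSwitch ζ Υ
    gain-switch : ∀ θ Υ → Υ ⟶ gainSwitch θ Υ
    reorientation : ∀ ρ Υ → Υ ⟶ reorient ρ Υ

  _⟶*_ : ∀ {n m} → GSG n m → GSG n m → Set c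
  _⟶*_ = Star _⟶_

  module _ {n m} (Υ : GSG n m) where

    data Step : Fin n → Fin n → Set where
      fwd : ∀ e {a b} → ends Υ e ≡ link a b → Step a b
      bwd : ∀ e {a b} → ends Υ e ≡ link a b → Step b a

    data Walk : Fin n → Fin n → Set where
      []  : ∀ {u} → Walk u u
      _∷_ : ∀ {u v w} → Step u v → Walk v w → Walk u w

  module _ {n m} {Υ : GSG n m} where

    stepEdge : ∀ {u v} → Step Υ u v → Fin m
    stepEdge (fwd e _) = e
    stepEdge (bwd e _) = e

    stepTau : ∀ {u v} → Step Υ u v → Sign
    stepTau (fwd e _) = τ₁ Υ e
    stepTau (bwd e _) = τ₂ Υ e

    revStep : ∀ {u v} → Step Υ u v → Step Υ v u
    revStep (fwd e p) = bwd e p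
    revStep (bwd e p) = fwd e p

    edges : ∀ {u w} → Walk Υ u w → List (Fin m)
    edges []      = []
    edges (s ∷ W) = stepEdge s ∷ edges W

    tails : ∀ {u w} → Walk Υ u w → List (Fin n)
    tails []            = []
    tails (_∷_ {u} s W) = u ∷ tails W

    verts : ∀ {u w} → Walk Υ u w → List (Fin n)
    verts {u} []   = u ∷ []
    verts {u} (s ∷ W) = u ∷ verts W

    sgn : ∀ {u w} → Walk Υ u w → Sign
    sgn []      = Sign.+
    sgn (s ∷ W) = σ Υ (stepEdge s) · sgn W

    -- φ(W) = - Σ φ(e_i) σ(W_{0,i-1}) τ(u_{i-1}, e_i)
    gain : ∀ {u w} → Walk Υ u w → K
    gain []      = 0#
    gain (s ∷ W) = - (φ Υ (stepEdge s) * ⟦ stepTau s ⟧) + ⟦ σ Υ (stepEdge s) ⟧ * gain W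

    _++ʷ_ : ∀ {u v w} → Walk Υ u v → Walk Υ v w → Walk Υ u w
    []      ++ʷ V = V
    (s ∷ W) ++ʷ V = s ∷ (W ++ʷ V)

    revʷ : ∀ {u w} → Walk Υ u w → Walk Υ w u
    revʷ []      = []
    revʷ (s ∷ W) = revʷ W ++ʷ (revStep s ∷ [])

    InS : Subset m → ∀ {u w} → Walk Υ u w → Set
    InS S W = All (_∈ S) (edges W)

    -- closed walk once around a circle in S
    IsCircle : Subset m → ∀ {u} → Walk Υ u u → Set
    IsCircle S C = 1 ≤ length (edges C) × Unique (edges C) × Unique (tails C) × InS S C

    IsPath : Subset m → ∀ {u w} → Walk Υ u w → Set
    IsPath S P = Unique (verts P) × InS S P

  module _ {n m} (Υ : GSG n m) (S : Subset m) where

    -- handcuff with two negative circles C₁ (at u), C₂ (at w) and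
    -- connecting path P from u to w (length 0 iff they share a vertex)
    CCHandcuff : ∀ {u w} → Walk Υ u u → Walk Υ w w → Walk Υ u w → Set
    CCHandcuff {u} {w} C₁ C₂ P =
      IsCircle S C₁ × sgn C₁ ≡ Sign.- ×
      IsCircle S C₂ × sgn C₂ ≡ Sign.- ×
      IsPath S P ×
      (∀ x → x ∈ₗ tails C₁ → x ∈ₗ tails C₂ → x ≡ u × x ≡ w) ×
      (∀ x → x ∈ₗ verts P → x ∈ₗ tails C₁ → x ≡ u) ×
      (∀ x → x ∈ₗ verts P → x ∈ₗ tails C₂ → x ≡ w) ×
      Unique (edges C₁ ++ edges C₂ ++ edges P)

    HCHandcuff : ∀ {u w} → Fin m → Walk Υ w w → Walk Υ u w → Set
    HCHandcuff {u} {w} h C₂ P =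
      h ∈ S × ends Υ h ≡ half u ×
      IsCircle S C₂ × sgn C₂ ≡ Sign.- ×
      IsPath S P ×
      (∀ x → x ∈ₗ verts P → x ∈ₗ tails C₂ → x ≡ w) ×
      Unique (edges C₂ ++ edges P)

    HHHandcuff : ∀ {u w} → Fin m → Fin m → Walk Υ u w → Set
    HHHandcuff {u} {w} h₁ h₂ P =
      h₁ ∈ S × h₂ ∈ S × h₁ ≢ h₂ ×
      ends Υ h₁ ≡ half u × ends Υ h₂ ≡ half w ×
      IsPath S P

    Neutral : K → Set ℓ
    Neutral x = x ≈ 0#

    -- all sign circuits in S are neutral
    Hyperbalanced : Set ℓ
    Hyperbalanced =
      (∀ e → e ∈ S → ends Υ e ≡ loose → Neutral (φ Υ e)) ×
      (∀ u (C : Walk Υ u u) → IsCircle S C → sgn C ≡ Sign.+ → Neutral (gain C)) ×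
      (∀ u w (C₁ : Walk Υ u u) (C₂ : Walk Υ w w) (P : Walk Υ u w) →
         CCHandcuff C₁ C₂ P →
         Neutral (gain (C₁ ++ʷ (P ++ʷ (C₂ ++ʷ revʷ P))))) ×
      (∀ u w h (C₂ : Walk Υ w w) (P : Walk Υ u w) →
         HCHandcuff h C₂ P →
         let W = P ++ʷ (C₂ ++ʷ revʷ P) in
         Neutral (⟦ τ₁ Υ h ⟧ * φ Υ h + gain W
                  + - (φ Υ h * ⟦ sgn W ⟧ * ⟦ τ₁ Υ h ⟧))) ×
      (∀ u w h₁ h₂ (P : Walk Υ u w) →
         HHHandcuff h₁ h₂ P →
         Neutral (⟦ τ₁ Υ h₁ ⟧ * φ Υ h₁ + gain P
                  + - (φ Υ h₂ * ⟦ sgn P ⟧ * ⟦ τ₁ Υ h₂ ⟧)))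

    Conn : Fin n → Fin n → Set
    Conn v w = Σ (Walk Υ v w) (InS S)

    BalancedAt : Fin n → Set
    BalancedAt v = ∀ x → Conn v x →
      (∀ h → h ∈ S → ends Υ h ≢ half x) ×
      (∀ (C : Walk Υ x x) → IsCircle S C → sgn C ≡ Sign.+)

    -- b_Σ(S) = k : there are exactly k sign-balanced components
    -- (a list of k pairwise non-connected balanced representatives
    --  meeting every balanced component)
    BCount : ℕ → Set
    BCount k = Σ (List (Fin n)) λ L →
      length L ≡ k × All BalancedAt L ×
      AllPairs (λ a b → ¬ Conn a b) L ×
      (∀ v → BalancedAt v → Any (Conn v) L)

    -- r(S) = n - b_Σ(S) + δ(S)
    IsRank : ℕ → Set ℓ
    IsRank r = Σ ℕ λ k → BCount k ×
      ((Hyperbalanced × r ≡ n ∸ k) ⊎ (¬ Hyperbalanced × r ≡ suc (n ∸ k)))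

  SameMatroid : ∀ {n m} → GSG n m → GSG n m → Set ℓ
  SameMatroid {n} {m} Υ Υ' = ∀ (S : Subset m) (r : ℕ) → (IsRank Υ S r → IsRank Υ' S r) × (IsRank Υ' S r → IsRank Υ S r)

  z : ∀ {n m} → GSG n m → Fin m → Fin (suc n) → K
  z Υ e zero = φ Υ e
  z Υ e (suc i) with ends Υ e
  ... | link a b = coef a (τ₁ Υ e) + coef b (τ₂ Υ e)
    where coef : _ → Sign → K
          coef a s = if does (a ≟ i) then ⟦ s ⟧ else 0#
  ... | half a = if does (a ≟ i) then ⟦ τ₁ Υ e ⟧ else 0#
  ... | loose  = 0#

  sumF : ∀ {m} → (Fin m → K) → K
  sumF {zero}  f = 0#
  sumF {suc m} f = f zero + sumF (λ i → f (suc i))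

  LinDep : ∀ {n m} → GSG n m → Subset m → Set (c ⊔ ℓ)
  LinDep {n} {m} Υ S = Σ (Fin m → K) λ cf →
    (∀ e → e ∉ S → cf e ≈ 0#) ×
    (∃ λ e → ¬ (cf e ≈ 0#)) ×
    (∀ i → sumF (λ e → cf e * z Υ e i) ≈ 0#)

{-# OPTIONS --safe #-}
-- Each of the three operations is a special case of a switching (α, β, κ): sign switching by
-- α : V → {±1}, gain switching by β : V → K and reversal of the edges e with κ(e) = -1, performed
-- at once.  A switching is undone by the switching (α, -αβ, κ), so every property only has to be
-- transferred in one direction.  A switching turns the sign of a walk W from u to w into
-- α(u)σ(W)α(w) and its gain into α(u)(φ(W) + σ(W)β(w) - β(u)), the β-terms of each edge
-- telescoping because τ(v,e)τ(w,e) = -σ(e).  On a positive closed walk, and on the ultrawalk of a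
-- handcuff with half edges, the boundary terms cancel, so the gain of every sign circuit is only
-- multiplied by the unit α(u); sign-balanced components are unchanged as well, hence so is the rank
-- function.  On the vectors z(e) a switching scales z(e) by κ(e), adds the combination
-- Σ β(v) z(e)ᵥ to coordinate 0 and scales coordinate v by α(v), which preserves linear dependence.
module Submission where

open import Defs
open import Algebra.Bundles using (CommutativeRing; Ring)
open import Data.Nat using (ℕ)
open import Data.Fin.Subset using (Subset)
open import Data.Product using (_×_)
open import Function.Bundles using (_⇔_)

open import Level using (_⊔_)
open import Data.Nat as ℕ using (zero; suc)
import Data.Nat.Properties as ℕₚ
open import Data.Integer as ℤ using (ℤ; +_; -[1+_]; _⊖_)
import Data.Integer.Properties as ℤₚ
open import Data.Fin using (Fin; zero; suc; _≟_)
open import Data.Fin.Subset using (_∈_; _∉_)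
open import Data.Sign as Sign using (Sign; opposite) renaming (_*_ to _·_)
import Data.Sign.Properties as Signₚ
open Signₚ using (s*s≡+; opposite-involutive)
  renaming (*-assoc to ·-assoc; *-comm to ·-comm; *-identityʳ to ·-identityʳ)
open import Data.Bool using (Bool; true; false; if_then_else_)
open import Data.Maybe using (Maybe; just; nothing)
open import Data.List using ([]; _∷_; _++_; length)
open import Data.List.Membership.Propositional using () renaming (_∈_ to _∈ₗ_)
open import Data.List.Relation.Unary.All as All using (All)
open import Data.List.Relation.Unary.Any as Any using (Any)
open import Data.List.Relation.Unary.AllPairs as AllPairs using (AllPairs)
open import Data.List.Relation.Unary.Unique.Propositional using (Unique)
open import Data.Product using (Σ; ∃; _,_; proj₁; proj₂)
open import Data.Sum using (inj₁; inj₂)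
open import Function using (_∘_)
open import Function.Bundles using (Equivalence; mk⇔)
open import Function.Construct.Identity using (⇔-id)
open import Function.Construct.Composition using (_⇔-∘_)
open import Relation.Nullary using (¬_; yes; no; does)
open import Relation.Binary.PropositionalEquality as ≡ using (_≡_; refl; cong; cong₂; subst)
open import Relation.Binary.Construct.Closure.ReflexiveTransitive using (ε; _◅_)
import Relation.Binary.Reasoning.Setoid as SetoidReasoning
open import Algebra.Properties.CommutativeSemigroup Signₚ.*-commutativeSemigroup
  using (interchange; xy∙z≈xz∙y; xy∙z≈zy∙x; x∙yz≈y∙xz; x∙yz≈xz∙y)
open import Algebra.Properties.AbelianGroup Signₚ.*-abelianGroup using (xyx⁻¹≈y)
open import Algebra.Solver.Ring.AlmostCommutativeRing
  using (_-Raw-AlmostCommutative⟶_; fromCommutativeRing)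

-- The ring solver for an arbitrary commutative ring, with integer coefficients.
module IntegerCoefficients {c ℓ} (R : CommutativeRing c ℓ) where
  open CommutativeRing R renaming (refl to ≈-refl; sym to ≈-sym; trans to ≈-trans)
  open import Algebra.Properties.Semiring.Mult.TCOptimised semiring
    using (×-homo-+; ×1-homo-*; 1+×) renaming (_×_ to _×ₙ_)
  open import Algebra.Properties.Ring ring using (-‿distribˡ-*; -‿distribʳ-*; -0#≈0#; -‿involutive)
  open import Algebra.Properties.AbelianGroup +-abelianGroup using (⁻¹-∙-comm)
  open import Relation.Binary.Reasoning.Setoid setoid

  ⟦_⟧ℤ : ℤ → Carrier
  ⟦ + n ⟧ℤ      = n ×ₙ 1#
  ⟦ -[1+ n ] ⟧ℤ = - (suc n ×ₙ 1#)

  private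
    cancel-1# : ∀ a b → (1# + a) + - (1# + b) ≈ a + - b
    cancel-1# a b = begin
      (1# + a) + - (1# + b)    ≈⟨ +-congˡ (≈-sym (⁻¹-∙-comm 1# b)) ⟩
      (1# + a) + (- 1# + - b)  ≈⟨ +-assoc 1# a _ ⟩
      1# + (a + (- 1# + - b))  ≈⟨ +-congˡ (≈-sym (+-assoc a _ _)) ⟩
      1# + ((a + - 1#) + - b)  ≈⟨ +-congˡ (+-congʳ (+-comm a _)) ⟩
      1# + ((- 1# + a) + - b)  ≈⟨ +-congˡ (+-assoc _ a _) ⟩
      1# + (- 1# + (a + - b))  ≈⟨ ≈-sym (+-assoc 1# _ _) ⟩
      (1# + - 1#) + (a + - b)  ≈⟨ +-congʳ (-‿inverseʳ 1#) ⟩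
      0# + (a + - b)           ≈⟨ +-identityˡ _ ⟩
      a + - b                  ∎

    +◃-homo : ∀ k → ⟦ Sign.+ ℤ.◃ k ⟧ℤ ≈ k ×ₙ 1#
    +◃-homo zero    = ≈-refl
    +◃-homo (suc k) = ≈-refl

    -◃-homo : ∀ k → ⟦ Sign.- ℤ.◃ k ⟧ℤ ≈ - (k ×ₙ 1#)
    -◃-homo zero    = ≈-sym -0#≈0#
    -◃-homo (suc k) = ≈-refl

  ⊖-homo : ∀ m n → ⟦ m ⊖ n ⟧ℤ ≈ m ×ₙ 1# + - (n ×ₙ 1#)
  ⊖-homo m       zero    rewrite ℤₚ.⊖-≥ {m} {0} ℕ.z≤n = ≈-sym (≈-trans (+-congˡ -0#≈0#) (+-identityʳ _))
  ⊖-homo zero    (suc n) rewrite ℤₚ.⊖-< {0} {suc n} (ℕ.s≤s ℕ.z≤n) = ≈-sym (+-identityˡ _)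
  ⊖-homo (suc m) (suc n) rewrite ℤₚ.[1+m]⊖[1+n]≡m⊖n m n = begin
    ⟦ m ⊖ n ⟧ℤ                              ≈⟨ ⊖-homo m n ⟩
    m ×ₙ 1# + - (n ×ₙ 1#)                   ≈⟨ ≈-sym (cancel-1# _ _) ⟩
    (1# + m ×ₙ 1#) + - (1# + n ×ₙ 1#)       ≈⟨ ≈-sym (+-cong (1+× m 1#) (-‿cong (1+× n 1#))) ⟩
    suc m ×ₙ 1# + - (suc n ×ₙ 1#)           ∎

  +-homo : ∀ i j → ⟦ i ℤ.+ j ⟧ℤ ≈ ⟦ i ⟧ℤ + ⟦ j ⟧ℤ
  +-homo (+ m)    (+ n)    = ×-homo-+ 1# m n
  +-homo (+ m)    -[1+ n ] = ⊖-homo m (suc n)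
  +-homo -[1+ m ] (+ n)    = ≈-trans (⊖-homo n (suc m)) (+-comm _ _)
  +-homo -[1+ m ] -[1+ n ] = begin
    - (suc (suc (m ℕ.+ n)) ×ₙ 1#)     ≈⟨ -‿cong (reflexive (cong (λ k → suc k ×ₙ 1#) (≡.sym (ℕₚ.+-suc m n)))) ⟩
    - ((suc m ℕ.+ suc n) ×ₙ 1#)       ≈⟨ -‿cong (×-homo-+ 1# (suc m) (suc n)) ⟩
    - (suc m ×ₙ 1# + suc n ×ₙ 1#)      ≈⟨ ≈-sym (⁻¹-∙-comm _ _) ⟩
    - (suc m ×ₙ 1#) + - (suc n ×ₙ 1#)  ∎

  *-homo : ∀ i j → ⟦ i ℤ.* j ⟧ℤ ≈ ⟦ i ⟧ℤ * ⟦ j ⟧ℤ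
  *-homo (+ m)    (+ n)    = ≈-trans (+◃-homo (m ℕ.* n)) (×1-homo-* m n)
  *-homo (+ m)    -[1+ n ] =
    ≈-trans (-◃-homo (m ℕ.* suc n)) (≈-trans (-‿cong (×1-homo-* m (suc n))) (-‿distribʳ-* _ _))
  *-homo -[1+ m ] (+ n)    =
    ≈-trans (-◃-homo (suc m ℕ.* n)) (≈-trans (-‿cong (×1-homo-* (suc m) n)) (-‿distribˡ-* _ _))
  *-homo -[1+ m ] -[1+ n ] = begin
    ⟦ Sign.+ ℤ.◃ (suc m ℕ.* suc n) ⟧ℤ  ≈⟨ +◃-homo (suc m ℕ.* suc n) ⟩
    (suc m ℕ.* suc n) ×ₙ 1#            ≈⟨ ×1-homo-* (suc m) (suc n) ⟩
    a * b                             ≈⟨ ≈-sym (-‿involutive _) ⟩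
    - - (a * b)                       ≈⟨ -‿cong (-‿distribˡ-* a b) ⟩
    - (- a * b)                       ≈⟨ -‿distribʳ-* _ _ ⟩
    - a * - b                         ∎
    where
    a b : Carrier
    a = suc m ×ₙ 1#
    b = suc n ×ₙ 1#

  neg-homo : ∀ i → ⟦ ℤ.- i ⟧ℤ ≈ - ⟦ i ⟧ℤ
  neg-homo (+ zero)  = ≈-sym -0#≈0#
  neg-homo (+ suc n) = ≈-refl
  neg-homo -[1+ n ]  = ≈-sym (-‿involutive _)

  morphism : Ring.rawRing ℤₚ.+-*-ring -Raw-AlmostCommutative⟶ fromCommutativeRing R
  morphism = record
    { ⟦_⟧ = ⟦_⟧ℤ ; +-homo = +-homo ; *-homo = *-homo ; -‿homo = neg-homo
    ; 0-homo = ≈-refl ; 1-homo = ≈-refl }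

  equal? : ∀ i j → Maybe (⟦ i ⟧ℤ ≈ ⟦ j ⟧ℤ)
  equal? i j with i ℤ.≟ j
  ... | yes ≡.refl = just ≈-refl
  ... | no _       = nothing

  open import Algebra.Solver.Ring (Ring.rawRing ℤₚ.+-*-ring) (fromCommutativeRing R) morphism equal? public
    using (solve; _:=_; con; _:+_; _:*_; :-_)

x∙xy≡y : ∀ x y → x · (x · y) ≡ y
x∙xy≡y Sign.+ y = refl
x∙xy≡y Sign.- y = opposite-involutive y

xy∙yz≡xz : ∀ x y z → (x · y) · (y · z) ≡ x · z
xy∙yz≡xz x y z = ≡.trans (·-assoc x y (y · z)) (cong (x ·_) (x∙xy≡y y z))

xyz∙zuw≡x∙yu∙w : ∀ x y z u w → (x · y · z) · (z · u · w) ≡ x · (y · u) · w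
xyz∙zuw≡x∙yu∙w x y z u w = begin
  (x · y · z) · (z · u · w)  ≡⟨ cong ((x · y · z) ·_) (·-assoc z u w) ⟩
  (x · y · z) · (z · (u · w))  ≡⟨ xy∙yz≡xz (x · y) z (u · w) ⟩
  (x · y) · (u · w)          ≡⟨ ≡.sym (·-assoc (x · y) u w) ⟩
  x · y · u · w              ≡⟨ cong (_· w) (·-assoc x y u) ⟩
  x · (y · u) · w            ∎
  where open ≡.≡-Reasoning

x∙xyz∙z≡y : ∀ x y z → x · (x · y · z) · z ≡ y
x∙xyz∙z≡y x y z = begin
  x · (x · y · z) · z    ≡⟨ cong (_· z) (≡.sym (·-assoc x (x · y) z)) ⟩
  x · (x · y) · z · z    ≡⟨ cong (λ t → t · z · z) (x∙xy≡y x y) ⟩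
  y · z · z              ≡⟨ ·-assoc y z z ⟩
  y · (z · z)            ≡⟨ cong (y ·_) (s*s≡+ z) ⟩
  y · Sign.+             ≡⟨ ·-identityʳ y ⟩
  y                      ∎
  where open ≡.≡-Reasoning

x∙y∙x∙yz≡z : ∀ x y z → x · (y · (x · (y · z))) ≡ z
x∙y∙x∙yz≡z x y z =
  ≡.trans (cong (x ·_) (≡.trans (x∙yz≈y∙xz y x (y · z)) (cong (x ·_) (x∙xy≡y y z)))) (x∙xy≡y x z)

wf-link-switch : ∀ a b k t₁ t₂ s → t₁ · t₂ ≡ opposite s →
                 (a · (k · t₁)) · (b · (k · t₂)) ≡ opposite (a · s · b)
wf-link-switch a b k t₁ t₂ s t₁t₂≡-s = begin
  (a · (k · t₁)) · (b · (k · t₂))   ≡⟨ interchange a (k · t₁) b (k · t₂) ⟩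
  (a · b) · ((k · t₁) · (k · t₂))   ≡⟨ cong ((a · b) ·_) (interchange k t₁ k t₂) ⟩
  (a · b) · ((k · k) · (t₁ · t₂))   ≡⟨ cong (λ x → (a · b) · (x · (t₁ · t₂))) (s*s≡+ k) ⟩
  (a · b) · (t₁ · t₂)               ≡⟨ cong ((a · b) ·_) t₁t₂≡-s ⟩
  (a · b) · (Sign.- · s)            ≡⟨ x∙yz≈y∙xz (a · b) Sign.- s ⟩
  opposite (a · b · s)              ≡⟨ cong opposite (xy∙z≈xz∙y a b s) ⟩
  opposite (a · s · b)              ∎
  where open ≡.≡-Reasoning

module _ {c ℓ} (R : CommutativeRing c ℓ) where
  open CommutativeRing R
    renaming (Carrier to K; refl to ≈-refl; sym to ≈-sym; trans to ≈-trans) hiding (zero)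
  open import Algebra.Properties.Ring ring using (-1*x≈-x; -‿involutive; -‿distribʳ-*)
  open import Algebra.Properties.CommutativeSemigroup *-commutativeSemigroup using ()
    renaming (x∙yz≈y∙xz to x*yz≈y*xz)
  open import Algebra.Properties.Semiring.Sum semiring
    using (sum; sum-cong-≋; ∑-distrib-+; ∑-comm; *-distribˡ-sum; sum-replicate-zero)
  module ≈-Reasoning = SetoidReasoning setoid
  open IntegerCoefficients R

  ⟪_⟫ : Sign → K
  ⟪ s ⟫ = ⟦_⟧ R s

  ⟪⟫-opposite : ∀ s → ⟪ opposite s ⟫ ≈ - ⟪ s ⟫
  ⟪⟫-opposite Sign.+ = ≈-refl
  ⟪⟫-opposite Sign.- = ≈-sym (-‿involutive 1#)

  ⟪⟫-homo : ∀ s t → ⟪ s · t ⟫ ≈ ⟪ s ⟫ * ⟪ t ⟫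
  ⟪⟫-homo Sign.+ t = ≈-sym (*-identityˡ ⟪ t ⟫)
  ⟪⟫-homo Sign.- t = ≈-trans (⟪⟫-opposite t) (≈-sym (-1*x≈-x ⟪ t ⟫))

  ⟪⟫-square : ∀ s → ⟪ s ⟫ * ⟪ s ⟫ ≈ 1#
  ⟪⟫-square s = ≈-trans (≈-sym (⟪⟫-homo s s)) (reflexive (cong ⟪_⟫ (s*s≡+ s)))

  ⟪⟫-cancel : ∀ s x → ⟪ s ⟫ * (⟪ s ⟫ * x) ≈ x
  ⟪⟫-cancel s x = begin
    ⟪ s ⟫ * (⟪ s ⟫ * x)  ≈⟨ ≈-sym (*-assoc _ _ x) ⟩
    ⟪ s ⟫ * ⟪ s ⟫ * x    ≈⟨ *-congʳ (⟪⟫-square s) ⟩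
    1# * x               ≈⟨ *-identityˡ x ⟩
    x                    ∎
    where open ≈-Reasoning

  ⟪⟫-cancel-inner : ∀ s t x → ⟪ s · t ⟫ * (⟪ t ⟫ * x) ≈ ⟪ s ⟫ * x
  ⟪⟫-cancel-inner s t x = begin
    ⟪ s · t ⟫ * (⟪ t ⟫ * x)      ≈⟨ *-congʳ (⟪⟫-homo s t) ⟩
    ⟪ s ⟫ * ⟪ t ⟫ * (⟪ t ⟫ * x)  ≈⟨ *-assoc _ _ _ ⟩
    ⟪ s ⟫ * (⟪ t ⟫ * (⟪ t ⟫ * x)) ≈⟨ *-congˡ (⟪⟫-cancel t x) ⟩
    ⟪ s ⟫ * x                    ∎
    where open ≈-Reasoning

  ⟪⟫-switch-end : ∀ a k t x y → ⟪ a · (k · t) ⟫ * (⟪ k ⟫ * (⟪ t ⟫ * x + y)) ≈ ⟪ a ⟫ * (x + ⟪ t ⟫ * y)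
  ⟪⟫-switch-end a k t x y = begin
    ⟪ a · (k · t) ⟫ * (⟪ k ⟫ * (⟪ t ⟫ * x + y))  ≈⟨ *-congʳ (reflexive (cong ⟪_⟫ (x∙yz≈xz∙y a k t))) ⟩
    ⟪ a · t · k ⟫ * (⟪ k ⟫ * (⟪ t ⟫ * x + y))    ≈⟨ ⟪⟫-cancel-inner (a · t) k _ ⟩
    ⟪ a · t ⟫ * (⟪ t ⟫ * x + y)                  ≈⟨ distribˡ _ _ _ ⟩
    ⟪ a · t ⟫ * (⟪ t ⟫ * x) + ⟪ a · t ⟫ * y      ≈⟨ +-cong (⟪⟫-cancel-inner a t x) (*-congʳ (⟪⟫-homo a t)) ⟩
    ⟪ a ⟫ * x + ⟪ a ⟫ * ⟪ t ⟫ * y                ≈⟨ +-congˡ (*-assoc _ _ _) ⟩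
    ⟪ a ⟫ * x + ⟪ a ⟫ * (⟪ t ⟫ * y)              ≈⟨ ≈-sym (distribˡ _ _ _) ⟩
    ⟪ a ⟫ * (x + ⟪ t ⟫ * y)                      ∎
    where open ≈-Reasoning

  ⟪⟫-unswitch-end : ∀ a k t x → ⟪ a · (k · t) ⟫ * - (⟪ a ⟫ * x) ≈ - (⟪ k ⟫ * (⟪ t ⟫ * x))
  ⟪⟫-unswitch-end a k t x = begin
    ⟪ a · (k · t) ⟫ * - (⟪ a ⟫ * x)    ≈⟨ ≈-sym (-‿distribʳ-* _ _) ⟩
    - (⟪ a · (k · t) ⟫ * (⟪ a ⟫ * x))  ≈⟨ -‿cong (*-congʳ (reflexive (cong ⟪_⟫ (·-comm a (k · t))))) ⟩
    - (⟪ k · t · a ⟫ * (⟪ a ⟫ * x))    ≈⟨ -‿cong (⟪⟫-cancel-inner (k · t) a x) ⟩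
    - (⟪ k · t ⟫ * x)                  ≈⟨ -‿cong (≈-trans (*-congʳ (⟪⟫-homo k t)) (*-assoc _ _ _)) ⟩
    - (⟪ k ⟫ * (⟪ t ⟫ * x))            ∎
    where open ≈-Reasoning

  ⟪⟫-cancel-pair : ∀ s x y → ⟪ s ⟫ * x * (⟪ s ⟫ * y) ≈ x * y
  ⟪⟫-cancel-pair s x y = ≈-trans (solve 3 (λ S x y → S :* x :* (S :* y) := S :* (S :* (x :* y))) ≈-refl _ x y)
                                 (⟪⟫-cancel s (x * y))

  neutral-reflect : ∀ s {x y} → x ≈ ⟪ s ⟫ * y → x ≈ 0# → y ≈ 0#
  neutral-reflect s {x} {y} x≈sy x≈0 = begin
    y                    ≈⟨ ≈-sym (⟪⟫-cancel s y) ⟩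
    ⟪ s ⟫ * (⟪ s ⟫ * y)  ≈⟨ *-congˡ (≈-sym x≈sy) ⟩
    ⟪ s ⟫ * x            ≈⟨ *-congˡ x≈0 ⟩
    ⟪ s ⟫ * 0#           ≈⟨ zeroʳ _ ⟩
    0#                   ∎
    where open ≈-Reasoning

  module _ {n m} {Υ : GSG R n m} where

    stepEdge-revStep : ∀ {u v} (s : Step R Υ u v) → stepEdge R (revStep R s) ≡ stepEdge R s
    stepEdge-revStep (fwd e p) = refl
    stepEdge-revStep (bwd e p) = refl

    sgn-++ʷ : ∀ {u v w} (W : Walk R Υ u v) (V : Walk R Υ v w) → sgn R (_++ʷ_ R W V) ≡ sgn R W · sgn R V
    sgn-++ʷ []      V = refl
    sgn-++ʷ (s ∷ W) V =
      ≡.trans (cong (σ Υ (stepEdge R s) ·_) (sgn-++ʷ W V)) (≡.sym (·-assoc (σ Υ (stepEdge R s)) (sgn R W) (sgn R V)))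

    sgn-revʷ : ∀ {u w} (W : Walk R Υ u w) → sgn R (revʷ R W) ≡ sgn R W
    sgn-revʷ []      = refl
    sgn-revʷ (s ∷ W) = begin
      sgn R (_++ʷ_ R (revʷ R W) (revStep R s ∷ []))   ≡⟨ sgn-++ʷ (revʷ R W) (revStep R s ∷ []) ⟩
      sgn R (revʷ R W) · (σ Υ (stepEdge R (revStep R s)) · Sign.+)
        ≡⟨ cong₂ _·_ (sgn-revʷ W) (≡.trans (·-identityʳ _) (cong (σ Υ) (stepEdge-revStep s))) ⟩
      sgn R W · σ Υ (stepEdge R s)                     ≡⟨ ·-comm (sgn R W) _ ⟩
      σ Υ (stepEdge R s) · sgn R W                     ∎
      where open ≡.≡-Reasoning

    lollipop : ∀ {u w} → Walk R Υ u w → Walk R Υ w w → Walk R Υ u u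
    lollipop P C = _++ʷ_ R P (_++ʷ_ R C (revʷ R P))

    handcuff : ∀ {u w} → Walk R Υ u u → Walk R Υ u w → Walk R Υ w w → Walk R Υ u u
    handcuff C₁ P C₂ = _++ʷ_ R C₁ (lollipop P C₂)

    sgn-lollipop : ∀ {u w} (P : Walk R Υ u w) (C : Walk R Υ w w) → sgn R (lollipop P C) ≡ sgn R C
    sgn-lollipop P C = begin
      sgn R (lollipop P C)                         ≡⟨ sgn-++ʷ P _ ⟩
      sgn R P · sgn R (_++ʷ_ R C (revʷ R P))       ≡⟨ cong (sgn R P ·_) (sgn-++ʷ C (revʷ R P)) ⟩
      sgn R P · (sgn R C · sgn R (revʷ R P))       ≡⟨ cong (λ t → sgn R P · (sgn R C · t)) (sgn-revʷ P) ⟩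
      sgn R P · (sgn R C · sgn R P)                ≡⟨ ≡.sym (·-assoc (sgn R P) (sgn R C) (sgn R P)) ⟩
      sgn R P · sgn R C · sgn R P                  ≡⟨ xyx⁻¹≈y (sgn R P) (sgn R C) ⟩
      sgn R C                                      ∎
      where open ≡.≡-Reasoning

    sgn-handcuff : ∀ {u w} (C₁ : Walk R Υ u u) (P : Walk R Υ u w) (C₂ : Walk R Υ w w) →
                   sgn R C₁ ≡ Sign.- → sgn R C₂ ≡ Sign.- → sgn R (handcuff C₁ P C₂) ≡ Sign.+
    sgn-handcuff C₁ P C₂ neg₁ neg₂ =
      ≡.trans (sgn-++ʷ C₁ (lollipop P C₂)) (cong₂ _·_ neg₁ (≡.trans (sgn-lollipop P C₂) neg₂))

    arrivalTau : ∀ {u v} → Step R Υ u v → Sign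
    arrivalTau (fwd e _) = τ₂ Υ e
    arrivalTau (bwd e _) = τ₁ Υ e

    stepTau-arrivalTau : WF R Υ → ∀ {u v} (s : Step R Υ u v) →
                         stepTau R s · arrivalTau s ≡ opposite (σ Υ (stepEdge R s))
    stepTau-arrivalTau wf (fwd e p) = subst (WFEdge R Υ e) p (wf e)
    stepTau-arrivalTau wf (bwd e p) = ≡.trans (·-comm (τ₂ Υ e) (τ₁ Υ e)) (subst (WFEdge R Υ e) p (wf e))

    ultrawalkGain : ∀ {u w} → Fin m → Walk R Υ u w → Fin m → K
    ultrawalkGain h₁ W h₂ = ⟪ τ₁ Υ h₁ ⟫ * φ Υ h₁ + gain R W + - (φ Υ h₂ * ⟪ sgn R W ⟫ * ⟪ τ₁ Υ h₂ ⟫)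

  module Retarget {n m} {Υ₁ Υ₂ : GSG R n m} (same-ends : ∀ e → ends Υ₂ e ≡ ends Υ₁ e) where

    retargetStep : ∀ {u v} → Step R Υ₁ u v → Step R Υ₂ u v
    retargetStep (fwd e p) = fwd e (≡.trans (same-ends e) p)
    retargetStep (bwd e p) = bwd e (≡.trans (same-ends e) p)

    retarget : ∀ {u w} → Walk R Υ₁ u w → Walk R Υ₂ u w
    retarget []      = []
    retarget (s ∷ W) = retargetStep s ∷ retarget W

    edges-retarget : ∀ {u w} (W : Walk R Υ₁ u w) → edges R (retarget W) ≡ edges R W
    edges-retarget []            = refl
    edges-retarget (fwd e p ∷ W) = cong (e ∷_) (edges-retarget W)
    edges-retarget (bwd e p ∷ W) = cong (e ∷_) (edges-retarget W)

    tails-retarget : ∀ {u w} (W : Walk R Υ₁ u w) → tails R (retarget W) ≡ tails R W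
    tails-retarget []      = refl
    tails-retarget (s ∷ W) = cong (_ ∷_) (tails-retarget W)

    verts-retarget : ∀ {u w} (W : Walk R Υ₁ u w) → verts R (retarget W) ≡ verts R W
    verts-retarget []      = refl
    verts-retarget (s ∷ W) = cong (_ ∷_) (verts-retarget W)

    ∈-tails-retarget : ∀ {x u w} (W : Walk R Υ₁ u w) → x ∈ₗ tails R (retarget W) → x ∈ₗ tails R W
    ∈-tails-retarget {x} W = subst (x ∈ₗ_) (tails-retarget W)

    ∈-verts-retarget : ∀ {x u w} (W : Walk R Υ₁ u w) → x ∈ₗ verts R (retarget W) → x ∈ₗ verts R W
    ∈-verts-retarget {x} W = subst (x ∈ₗ_) (verts-retarget W)

    retarget-++ʷ : ∀ {u v w} (W : Walk R Υ₁ u v) (V : Walk R Υ₁ v w) →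
                   retarget (_++ʷ_ R W V) ≡ _++ʷ_ R (retarget W) (retarget V)
    retarget-++ʷ []      V = refl
    retarget-++ʷ (s ∷ W) V = cong (retargetStep s ∷_) (retarget-++ʷ W V)

    retarget-revʷ : ∀ {u w} (W : Walk R Υ₁ u w) → retarget (revʷ R W) ≡ revʷ R (retarget W)
    retarget-revʷ []            = refl
    retarget-revʷ (fwd e p ∷ W) = ≡.trans (retarget-++ʷ (revʷ R W) _) (cong (λ V → _++ʷ_ R V _) (retarget-revʷ W))
    retarget-revʷ (bwd e p ∷ W) = ≡.trans (retarget-++ʷ (revʷ R W) _) (cong (λ V → _++ʷ_ R V _) (retarget-revʷ W))

    retarget-lollipop : ∀ {u w} (P : Walk R Υ₁ u w) (C : Walk R Υ₁ w w) →
                        retarget (lollipop P C) ≡ lollipop (retarget P) (retarget C)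
    retarget-lollipop P C = begin
      retarget (lollipop P C)                                       ≡⟨ retarget-++ʷ P _ ⟩
      _++ʷ_ R (retarget P) (retarget (_++ʷ_ R C (revʷ R P)))        ≡⟨ cong (_++ʷ_ R (retarget P)) (retarget-++ʷ C _) ⟩
      _++ʷ_ R (retarget P) (_++ʷ_ R (retarget C) (retarget (revʷ R P)))
        ≡⟨ cong (λ V → _++ʷ_ R (retarget P) (_++ʷ_ R (retarget C) V)) (retarget-revʷ P) ⟩
      lollipop (retarget P) (retarget C)                            ∎
      where open ≡.≡-Reasoning

    retarget-handcuff : ∀ {u w} (C₁ : Walk R Υ₁ u u) (P : Walk R Υ₁ u w) (C₂ : Walk R Υ₁ w w) →
                        retarget (handcuff C₁ P C₂) ≡ handcuff (retarget C₁) (retarget P) (retarget C₂)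
    retarget-handcuff C₁ P C₂ =
      ≡.trans (retarget-++ʷ C₁ _) (cong (_++ʷ_ R (retarget C₁)) (retarget-lollipop P C₂))

    module _ {S : Subset m} where

      inS-retarget : ∀ {u w} {W : Walk R Υ₁ u w} → InS R S W → InS R S (retarget W)
      inS-retarget {W = W} = subst (All (_∈ S)) (≡.sym (edges-retarget W))

      isCircle-retarget : ∀ {u} {C : Walk R Υ₁ u u} → IsCircle R S C → IsCircle R S (retarget C)
      isCircle-retarget {C = C} (nonempty , edges! , tails! , inS) =
        subst (λ L → 1 ℕ.≤ length L) (≡.sym (edges-retarget C)) nonempty ,
        subst Unique (≡.sym (edges-retarget C)) edges! ,
        subst Unique (≡.sym (tails-retarget C)) tails! ,
        inS-retarget inS

      isPath-retarget : ∀ {u w} {P : Walk R Υ₁ u w} → IsPath R S P → IsPath R S (retarget P)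
      isPath-retarget {P = P} (verts! , inS) = subst Unique (≡.sym (verts-retarget P)) verts! , inS-retarget inS

      conn-retarget : ∀ {u w} → Conn R Υ₁ S u w → Conn R Υ₂ S u w
      conn-retarget (W , inS) = retarget W , inS-retarget inS

      module _ (sgn-closed : ∀ {u} (C : Walk R Υ₁ u u) → sgn R (retarget C) ≡ sgn R C) where

        ccHandcuff-retarget : ∀ {u w} {C₁ : Walk R Υ₁ u u} {C₂ : Walk R Υ₁ w w} {P : Walk R Υ₁ u w} →
          CCHandcuff R Υ₁ S C₁ C₂ P → CCHandcuff R Υ₂ S (retarget C₁) (retarget C₂) (retarget P)
        ccHandcuff-retarget {C₁ = C₁} {C₂} {P}
          (circle₁ , neg₁ , circle₂ , neg₂ , path , meet₁₂ , meetP₁ , meetP₂ , edges!) =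
          isCircle-retarget circle₁ , ≡.trans (sgn-closed C₁) neg₁ ,
          isCircle-retarget circle₂ , ≡.trans (sgn-closed C₂) neg₂ ,
          isPath-retarget path ,
          (λ x i j → meet₁₂ x (∈-tails-retarget C₁ i) (∈-tails-retarget C₂ j)) ,
          (λ x i j → meetP₁ x (∈-verts-retarget P i) (∈-tails-retarget C₁ j)) ,
          (λ x i j → meetP₂ x (∈-verts-retarget P i) (∈-tails-retarget C₂ j)) ,
          subst Unique (≡.sym (cong₂ _++_ (edges-retarget C₁) (cong₂ _++_ (edges-retarget C₂) (edges-retarget P)))) edges!

        hcHandcuff-retarget : ∀ {u w h} {C₂ : Walk R Υ₁ w w} {P : Walk R Υ₁ u w} →
          HCHandcuff R Υ₁ S h C₂ P → HCHandcuff R Υ₂ S h (retarget C₂) (retarget P)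
        hcHandcuff-retarget {h = h} {C₂} {P} (h∈S , half-h , circle₂ , neg₂ , path , meetP₂ , edges!) =
          h∈S , ≡.trans (same-ends h) half-h ,
          isCircle-retarget circle₂ , ≡.trans (sgn-closed C₂) neg₂ ,
          isPath-retarget path ,
          (λ x i j → meetP₂ x (∈-verts-retarget P i) (∈-tails-retarget C₂ j)) ,
          subst Unique (≡.sym (cong₂ _++_ (edges-retarget C₂) (edges-retarget P))) edges!

      hhHandcuff-retarget : ∀ {u w h₁ h₂} {P : Walk R Υ₁ u w} →
        HHHandcuff R Υ₁ S h₁ h₂ P → HHHandcuff R Υ₂ S h₁ h₂ (retarget P)
      hhHandcuff-retarget {h₁ = h₁} {h₂} (h₁∈S , h₂∈S , h₁≢h₂ , half-h₁ , half-h₂ , path) =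
        h₁∈S , h₂∈S , h₁≢h₂ , ≡.trans (same-ends h₁) half-h₁ , ≡.trans (same-ends h₂) half-h₂ ,
        isPath-retarget path

  switch-gain-step : ∀ a b k t t' σ p x y z φ g → ⟪ t ⟫ * ⟪ t' ⟫ ≈ - ⟪ σ ⟫ →
    - (⟪ k ⟫ * (⟪ t ⟫ * x + (φ + ⟪ t' ⟫ * y)) * ⟪ a · (k · t) ⟫) + ⟪ a · σ · b ⟫ * (⟪ b ⟫ * (g + ⟪ p ⟫ * z + - y))
      ≈ ⟪ a ⟫ * (- (φ * ⟪ t ⟫) + ⟪ σ ⟫ * g + ⟪ σ · p ⟫ * z + - x)
  switch-gain-step a b k t t' σ p x y z φ g tt'≈-σ = begin
    - (⟪ k ⟫ * (⟪ t ⟫ * x + (φ + ⟪ t' ⟫ * y)) * ⟪ a · (k · t) ⟫) + ⟪ a · σ · b ⟫ * (⟪ b ⟫ * G)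
      ≈⟨ +-cong (-‿cong (≈-trans (*-comm _ _) (⟪⟫-switch-end a k t x _))) (⟪⟫-cancel-inner (a · σ) b G) ⟩
    - (⟪ a ⟫ * (x + ⟪ t ⟫ * (φ + ⟪ t' ⟫ * y))) + ⟪ a · σ ⟫ * G
      ≈⟨ +-cong (-‿cong (*-congˡ (+-congˡ arrival))) (*-congʳ (⟪⟫-homo a σ)) ⟩
    - (⟪ a ⟫ * (x + (⟪ t ⟫ * φ + - ⟪ σ ⟫ * y))) + ⟪ a ⟫ * ⟪ σ ⟫ * G
      ≈⟨ solve 9 (λ A Σ T P x y z φ g →
                    :- (A :* (x :+ (T :* φ :+ :- Σ :* y))) :+ A :* Σ :* (g :+ P :* z :+ :- y)
                 := A :* (:- (φ :* T) :+ Σ :* g :+ Σ :* P :* z :+ :- x))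
               ≈-refl ⟪ a ⟫ ⟪ σ ⟫ ⟪ t ⟫ ⟪ p ⟫ x y z φ g ⟩
    ⟪ a ⟫ * (- (φ * ⟪ t ⟫) + ⟪ σ ⟫ * g + ⟪ σ ⟫ * ⟪ p ⟫ * z + - x)
      ≈⟨ *-congˡ (+-congʳ (+-congˡ (*-congʳ (≈-sym (⟪⟫-homo σ p))))) ⟩
    ⟪ a ⟫ * (- (φ * ⟪ t ⟫) + ⟪ σ ⟫ * g + ⟪ σ · p ⟫ * z + - x) ∎
    where
    open ≈-Reasoning
    G : K
    G = g + ⟪ p ⟫ * z + - y
    arrival : ⟪ t ⟫ * (φ + ⟪ t' ⟫ * y) ≈ ⟪ t ⟫ * φ + - ⟪ σ ⟫ * y
    arrival = ≈-trans (distribˡ _ _ _) (+-congˡ (≈-trans (≈-sym (*-assoc _ _ y)) (*-congʳ tt'≈-σ)))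

  switch-ultrawalk : ∀ a b k l t r p x y φ ψ g →
    ⟪ a · (k · t) ⟫ * (⟪ k ⟫ * (⟪ t ⟫ * x + φ)) + ⟪ a ⟫ * (g + ⟪ p ⟫ * y + - x)
      + - (⟪ l ⟫ * (⟪ r ⟫ * y + ψ) * ⟪ a · p · b ⟫ * ⟪ b · (l · r) ⟫)
      ≈ ⟪ a ⟫ * (⟪ t ⟫ * φ + g + - (ψ * ⟪ p ⟫ * ⟪ r ⟫))
  switch-ultrawalk a b k l t r p x y φ ψ g = begin
    ⟪ a · (k · t) ⟫ * (⟪ k ⟫ * (⟪ t ⟫ * x + φ)) + ⟪ a ⟫ * (g + ⟪ p ⟫ * y + - x) + - (Y * ⟪ a · p · b ⟫ * ⟪ b · (l · r) ⟫)
      ≈⟨ +-cong (+-congʳ (⟪⟫-switch-end a k t x φ)) (-‿cong last) ⟩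
    ⟪ a ⟫ * (x + ⟪ t ⟫ * φ) + ⟪ a ⟫ * (g + ⟪ p ⟫ * y + - x) + - (⟪ a ⟫ * ⟪ p ⟫ * (y + ⟪ r ⟫ * ψ))
      ≈⟨ solve 9 (λ A T P Rr x y φ ψ g →
                    A :* (x :+ T :* φ) :+ A :* (g :+ P :* y :+ :- x) :+ :- (A :* P :* (y :+ Rr :* ψ))
                 := A :* (T :* φ :+ g :+ :- (ψ :* P :* Rr)))
               ≈-refl ⟪ a ⟫ ⟪ t ⟫ ⟪ p ⟫ ⟪ r ⟫ x y φ ψ g ⟩
    ⟪ a ⟫ * (⟪ t ⟫ * φ + g + - (ψ * ⟪ p ⟫ * ⟪ r ⟫)) ∎
    where
    open ≈-Reasoning
    Y : K
    Y = ⟪ l ⟫ * (⟪ r ⟫ * y + ψ)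
    last : Y * ⟪ a · p · b ⟫ * ⟪ b · (l · r) ⟫ ≈ ⟪ a ⟫ * ⟪ p ⟫ * (y + ⟪ r ⟫ * ψ)
    last = begin
      Y * ⟪ a · p · b ⟫ * ⟪ b · (l · r) ⟫       ≈⟨ solve 3 (λ u v w → u :* v :* w := v :* (w :* u)) ≈-refl Y _ _ ⟩
      ⟪ a · p · b ⟫ * (⟪ b · (l · r) ⟫ * Y)     ≈⟨ *-congˡ (⟪⟫-switch-end b l r y ψ) ⟩
      ⟪ a · p · b ⟫ * (⟪ b ⟫ * (y + ⟪ r ⟫ * ψ)) ≈⟨ ⟪⟫-cancel-inner (a · p) b _ ⟩
      ⟪ a · p ⟫ * (y + ⟪ r ⟫ * ψ)               ≈⟨ *-congʳ (⟪⟫-homo a p) ⟩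
      ⟪ a ⟫ * ⟪ p ⟫ * (y + ⟪ r ⟫ * ψ)           ∎

  SwitchedEdge : ∀ {n m} → (Fin n → Sign) → (Fin n → K) → (Fin m → Sign) →
                 GSG R n m → GSG R n m → Fin m → Ends n → Set ℓ
  SwitchedEdge α β κ Υ Υ' e (link a b) =
    σ Υ' e ≡ α a · σ Υ e · α b × τ₁ Υ' e ≡ α a · (κ e · τ₁ Υ e) × τ₂ Υ' e ≡ α b · (κ e · τ₂ Υ e) ×
    φ Υ' e ≈ ⟪ κ e ⟫ * (⟪ τ₁ Υ e ⟫ * β a + φ Υ e + ⟪ τ₂ Υ e ⟫ * β b)
  SwitchedEdge α β κ Υ Υ' e (half a) =
    σ Υ' e ≡ σ Υ e × τ₁ Υ' e ≡ α a · (κ e · τ₁ Υ e) × φ Υ' e ≈ ⟪ κ e ⟫ * (⟪ τ₁ Υ e ⟫ * β a + φ Υ e)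
  SwitchedEdge α β κ Υ Υ' e loose =
    σ Υ' e ≡ σ Υ e × φ Υ' e ≈ ⟪ κ e ⟫ * φ Υ e

  record Switching {n m} (Υ Υ' : GSG R n m) : Set (c ⊔ ℓ) where
    field
      α         : Fin n → Sign
      β         : Fin n → K
      κ         : Fin m → Sign
      same-ends : ∀ e → ends Υ' e ≡ ends Υ e
      switched  : ∀ e → SwitchedEdge α β κ Υ Υ' e (ends Υ e)

    open Retarget {Υ₁ = Υ} {Υ₂ = Υ'} same-ends public

    switchedAt : ∀ e {x} → ends Υ e ≡ x → SwitchedEdge α β κ Υ Υ' e x
    switchedAt e p = subst (SwitchedEdge α β κ Υ Υ' e) p (switched e)

    switchedStep : ∀ {u v} (s : Step R Υ u v) → let e = stepEdge R s ; e' = stepEdge R (retargetStep s) in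
      σ Υ' e' ≡ α u · σ Υ e · α v ×
      stepTau R (retargetStep s) ≡ α u · (κ e · stepTau R s) ×
      φ Υ' e' ≈ ⟪ κ e ⟫ * (⟪ stepTau R s ⟫ * β u + (φ Υ e + ⟪ arrivalTau s ⟫ * β v))
    switchedStep (fwd e p) with switchedAt e p
    ... | σ≡ , τ₁≡ , _ , φ≈ = σ≡ , τ₁≡ , ≈-trans φ≈ (*-congˡ (+-assoc _ _ _))
    switchedStep (bwd e {a} {b} p) with switchedAt e p
    ... | σ≡ , _ , τ₂≡ , φ≈ =
      ≡.trans σ≡ (xy∙z≈zy∙x (α a) (σ Υ e) (α b)) , τ₂≡ ,
      ≈-trans φ≈ (*-congˡ (solve 3 (λ x y z → x :+ y :+ z := z :+ (y :+ x)) ≈-refl _ _ _))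

    sgn-retarget : ∀ {u w} (W : Walk R Υ u w) → sgn R (retarget W) ≡ α u · sgn R W · α w
    sgn-retarget {u} [] = ≡.sym (xyx⁻¹≈y (α u) Sign.+)
    sgn-retarget {u} {w} (_∷_ {v = v} s W) =
      ≡.trans (cong₂ _·_ (proj₁ (switchedStep s)) (sgn-retarget W))
              (xyz∙zuw≡x∙yu∙w (α u) (σ Υ (stepEdge R s)) (α v) (sgn R W) (α w))

    sgn-retarget-closed : ∀ {u} (C : Walk R Υ u u) → sgn R (retarget C) ≡ sgn R C
    sgn-retarget-closed {u} C = ≡.trans (sgn-retarget C) (xyx⁻¹≈y (α u) (sgn R C))

    gain-retarget : WF R Υ → ∀ {u w} (W : Walk R Υ u w) →
                    gain R (retarget W) ≈ ⟪ α u ⟫ * (gain R W + ⟪ sgn R W ⟫ * β w + - β u)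
    gain-retarget wf {u} [] =
      solve 2 (λ A x → con (+ 0) := A :* (con (+ 0) :+ con (+ 1) :* x :+ :- x)) ≈-refl ⟪ α u ⟫ (β u)
    gain-retarget wf {u} {w} (_∷_ {v = v} s W) with switchedStep s
    ... | σ≡ , τ≡ , φ≈ =
      ≈-trans (+-cong (-‿cong (*-cong φ≈ (reflexive (cong ⟪_⟫ τ≡))))
                      (*-cong (reflexive (cong ⟪_⟫ σ≡)) (gain-retarget wf W)))
              (switch-gain-step (α u) (α v) (κ e) (stepTau R s) (arrivalTau s) (σ Υ e) (sgn R W)
                                (β u) (β v) (β w) (φ Υ e) (gain R W) arrival)
      where
      e : Fin m
      e = stepEdge R s
      arrival : ⟪ stepTau R s ⟫ * ⟪ arrivalTau s ⟫ ≈ - ⟪ σ Υ e ⟫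
      arrival = ≈-trans (≈-sym (⟪⟫-homo (stepTau R s) (arrivalTau s)))
                        (≈-trans (reflexive (cong ⟪_⟫ (stepTau-arrivalTau wf s))) (⟪⟫-opposite (σ Υ e)))

    gain-retarget-closed : WF R Υ → ∀ {u} (C : Walk R Υ u u) → sgn R C ≡ Sign.+ →
                           gain R (retarget C) ≈ ⟪ α u ⟫ * gain R C
    gain-retarget-closed wf {u} C positive = ≈-trans (gain-retarget wf C) (*-congˡ (begin
      gain R C + ⟪ sgn R C ⟫ * β u + - β u  ≈⟨ +-congʳ (+-congˡ (*-congʳ (reflexive (cong ⟪_⟫ positive)))) ⟩
      gain R C + 1# * β u + - β u           ≈⟨ solve 2 (λ g x → g :+ con (+ 1) :* x :+ :- x := g) ≈-refl _ _ ⟩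
      gain R C                              ∎))
      where open ≈-Reasoning

    ultrawalkGain-retarget : WF R Υ → ∀ {u w h₁ h₂} → ends Υ h₁ ≡ half u → ends Υ h₂ ≡ half w →
      (W : Walk R Υ u w) → ultrawalkGain h₁ (retarget W) h₂ ≈ ⟪ α u ⟫ * ultrawalkGain h₁ W h₂
    ultrawalkGain-retarget wf {u} {w} {h₁} {h₂} half₁ half₂ W
      with switchedAt h₁ half₁ | switchedAt h₂ half₂
    ... | _ , τ≡₁ , φ≈₁ | _ , τ≡₂ , φ≈₂ =
      ≈-trans (+-cong (+-cong (*-cong (reflexive (cong ⟪_⟫ τ≡₁)) φ≈₁) (gain-retarget wf W))
                      (-‿cong (*-cong (*-cong φ≈₂ (reflexive (cong ⟪_⟫ (sgn-retarget W))))
                                      (reflexive (cong ⟪_⟫ τ≡₂)))))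
              (switch-ultrawalk (α u) (α w) (κ h₁) (κ h₂) (τ₁ Υ h₁) (τ₁ Υ h₂) (sgn R W)
                                (β u) (β w) (φ Υ h₁) (φ Υ h₂) (gain R W))

  unswitch-link-gain : ∀ {φ φ'} a b k t₁ t₂ x y → φ' ≈ ⟪ k ⟫ * (⟪ t₁ ⟫ * x + φ + ⟪ t₂ ⟫ * y) →
    φ ≈ ⟪ k ⟫ * (⟪ a · (k · t₁) ⟫ * - (⟪ a ⟫ * x) + φ' + ⟪ b · (k · t₂) ⟫ * - (⟪ b ⟫ * y))
  unswitch-link-gain {φ} {φ'} a b k t₁ t₂ x y φ'≈ = begin
    φ                      ≈⟨ ≈-sym (⟪⟫-cancel k φ) ⟩
    ⟪ k ⟫ * (⟪ k ⟫ * φ)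
      ≈⟨ *-congˡ (solve 6 (λ K T₁ T₂ φ x y →
                              K :* φ := :- (K :* (T₁ :* x)) :+ K :* (T₁ :* x :+ φ :+ T₂ :* y) :+ :- (K :* (T₂ :* y)))
                           ≈-refl ⟪ k ⟫ ⟪ t₁ ⟫ ⟪ t₂ ⟫ φ x y) ⟩
    ⟪ k ⟫ * (- (⟪ k ⟫ * (⟪ t₁ ⟫ * x)) + ⟪ k ⟫ * (⟪ t₁ ⟫ * x + φ + ⟪ t₂ ⟫ * y) + - (⟪ k ⟫ * (⟪ t₂ ⟫ * y)))
      ≈⟨ *-congˡ (+-cong (+-cong (≈-sym (⟪⟫-unswitch-end a k t₁ x)) (≈-sym φ'≈)) (≈-sym (⟪⟫-unswitch-end b k t₂ y))) ⟩
    ⟪ k ⟫ * (⟪ a · (k · t₁) ⟫ * - (⟪ a ⟫ * x) + φ' + ⟪ b · (k · t₂) ⟫ * - (⟪ b ⟫ * y)) ∎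
    where open ≈-Reasoning

  unswitch-half-gain : ∀ {φ φ'} a k t x → φ' ≈ ⟪ k ⟫ * (⟪ t ⟫ * x + φ) →
    φ ≈ ⟪ k ⟫ * (⟪ a · (k · t) ⟫ * - (⟪ a ⟫ * x) + φ')
  unswitch-half-gain {φ} {φ'} a k t x φ'≈ = begin
    φ                      ≈⟨ ≈-sym (⟪⟫-cancel k φ) ⟩
    ⟪ k ⟫ * (⟪ k ⟫ * φ)
      ≈⟨ *-congˡ (solve 4 (λ K T φ x → K :* φ := :- (K :* (T :* x)) :+ K :* (T :* x :+ φ))
                           ≈-refl ⟪ k ⟫ ⟪ t ⟫ φ x) ⟩
    ⟪ k ⟫ * (- (⟪ k ⟫ * (⟪ t ⟫ * x)) + ⟪ k ⟫ * (⟪ t ⟫ * x + φ))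
      ≈⟨ *-congˡ (+-cong (≈-sym (⟪⟫-unswitch-end a k t x)) (≈-sym φ'≈)) ⟩
    ⟪ k ⟫ * (⟪ a · (k · t) ⟫ * - (⟪ a ⟫ * x) + φ') ∎
    where open ≈-Reasoning

  switching-sym : ∀ {n m} {Υ Υ' : GSG R n m} → Switching Υ Υ' → Switching Υ' Υ
  switching-sym {n} {m} {Υ} {Υ'} sw = record
    { α = α ; β = β⁻ ; κ = κ
    ; same-ends = λ e → ≡.sym (same-ends e)
    ; switched = λ e → subst (SwitchedEdge α β⁻ κ Υ' Υ e) (≡.sym (same-ends e)) (unswitched e (ends Υ e) (switched e))
    }
    where
    open Switching sw
    β⁻ : Fin n → K
    β⁻ v = - (⟪ α v ⟫ * β v)
    unswitched : ∀ e x → SwitchedEdge α β κ Υ Υ' e x → SwitchedEdge α β⁻ κ Υ' Υ e x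
    unswitched e (link a b) (σ≡ , τ₁≡ , τ₂≡ , φ≈) rewrite σ≡ | τ₁≡ | τ₂≡ =
      ≡.sym (x∙xyz∙z≡y (α a) (σ Υ e) (α b)) ,
      ≡.sym (x∙y∙x∙yz≡z (α a) (κ e) (τ₁ Υ e)) , ≡.sym (x∙y∙x∙yz≡z (α b) (κ e) (τ₂ Υ e)) ,
      unswitch-link-gain (α a) (α b) (κ e) (τ₁ Υ e) (τ₂ Υ e) (β a) (β b) φ≈
    unswitched e (half a) (σ≡ , τ₁≡ , φ≈) rewrite τ₁≡ =
      ≡.sym σ≡ , ≡.sym (x∙y∙x∙yz≡z (α a) (κ e) (τ₁ Υ e)) , unswitch-half-gain (α a) (κ e) (τ₁ Υ e) (β a) φ≈
    unswitched e loose (σ≡ , φ≈) = ≡.sym σ≡ , ≈-trans (≈-sym (⟪⟫-cancel (κ e) (φ Υ e))) (*-congˡ (≈-sym φ≈))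

  wf-switch : ∀ {n m} {Υ Υ' : GSG R n m} → Switching Υ Υ' → WF R Υ → WF R Υ'
  wf-switch {Υ = Υ} {Υ'} sw wf e rewrite Switching.same-ends sw e
    with ends Υ e | wf e | Switching.switched sw e
  ... | link a b | τ₁τ₂≡-σ | σ≡ , τ₁≡ , τ₂≡ , _ rewrite σ≡ | τ₁≡ | τ₂≡ =
    wf-link-switch (α a) (α b) (κ e) (τ₁ Υ e) (τ₂ Υ e) (σ Υ e) τ₁τ₂≡-σ
    where open Switching sw
  ... | half a   | negative | σ≡ , _ = ≡.trans σ≡ negative
  ... | loose    | positive | σ≡ , _ = ≡.trans σ≡ positive

  shift-by-zero-link : ∀ k t t' φ → ⟪ k ⟫ * φ ≈ ⟪ k ⟫ * (t * 0# + φ + t' * 0#)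
  shift-by-zero-link k t t' φ =
    *-congˡ (solve 3 (λ t t' f → f := t :* con (+ 0) :+ f :+ t' :* con (+ 0)) ≈-refl t t' φ)

  shift-by-zero-half : ∀ k t φ → ⟪ k ⟫ * φ ≈ ⟪ k ⟫ * (t * 0# + φ)
  shift-by-zero-half k t φ = *-congˡ (solve 2 (λ t f → f := t :* con (+ 0) :+ f) ≈-refl t φ)

  signSwitch-switching : ∀ {n m} (ζ : Fin n → Sign) (Υ : GSG R n m) → Switching Υ (signSwitch R ζ Υ)
  signSwitch-switching ζ Υ = record
    { α = ζ ; β = λ _ → 0# ; κ = λ _ → Sign.+ ; same-ends = λ _ → refl ; switched = switched }
    where
    switched : ∀ e → SwitchedEdge ζ (λ _ → 0#) (λ _ → Sign.+) Υ (signSwitch R ζ Υ) e (ends Υ e)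
    switched e with ends Υ e in ends≡
    ... | link a b rewrite ends≡ =
      refl , refl , refl , ≈-trans (≈-sym (*-identityˡ _)) (shift-by-zero-link Sign.+ _ _ _)
    ... | half a   rewrite ends≡ = refl , refl , ≈-trans (≈-sym (*-identityˡ _)) (shift-by-zero-half Sign.+ _ _)
    ... | loose    rewrite ends≡ = refl , ≈-sym (*-identityˡ _)

  gainSwitch-switching : ∀ {n m} (θ : Fin n → K) (Υ : GSG R n m) → Switching Υ (gainSwitch R θ Υ)
  gainSwitch-switching θ Υ = record
    { α = λ _ → Sign.+ ; β = θ ; κ = λ _ → Sign.+ ; same-ends = λ _ → refl ; switched = switched }
    where
    switched : ∀ e → SwitchedEdge (λ _ → Sign.+) θ (λ _ → Sign.+) Υ (gainSwitch R θ Υ) e (ends Υ e)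
    switched e with ends Υ e in ends≡
    ... | link a b rewrite ends≡ = ≡.sym (·-identityʳ (σ Υ e)) , refl , refl , ≈-sym (*-identityˡ _)
    ... | half a   rewrite ends≡ = refl , refl , ≈-sym (*-identityˡ _)
    ... | loose    rewrite ends≡ = refl , ≈-sym (*-identityˡ _)

  reorient-switching : ∀ {n m} (ρ : Fin m → Bool) (Υ : GSG R n m) → Switching Υ (reorient R ρ Υ)
  reorient-switching {m = m} ρ Υ = record
    { α = λ _ → Sign.+ ; β = λ _ → 0# ; κ = κ ; same-ends = λ _ → refl ; switched = switched }
    where
    κ : Fin m → Sign
    κ e = if ρ e then Sign.- else Sign.+

    reoriented-τ : ∀ e t → (if ρ e then opposite t else t) ≡ κ e · t
    reoriented-τ e t with ρ e
    ... | true  = refl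
    ... | false = refl

    reoriented-φ : ∀ e x → (if ρ e then - x else x) ≈ ⟪ κ e ⟫ * x
    reoriented-φ e x with ρ e
    ... | true  = ≈-sym (-1*x≈-x x)
    ... | false = ≈-sym (*-identityˡ x)

    switched : ∀ e → SwitchedEdge (λ _ → Sign.+) (λ _ → 0#) κ Υ (reorient R ρ Υ) e (ends Υ e)
    switched e with ends Υ e
    ... | link a b = ≡.sym (·-identityʳ (σ Υ e)) , reoriented-τ e _ , reoriented-τ e _ ,
                     ≈-trans (reoriented-φ e _) (shift-by-zero-link (κ e) _ _ _)
    ... | half a   = refl , reoriented-τ e _ , ≈-trans (reoriented-φ e _) (shift-by-zero-half (κ e) _ _)
    ... | loose    = refl , reoriented-φ e _

  switching : ∀ {n m} {Υ Υ' : GSG R n m} → _⟶_ R Υ Υ' → Switching Υ Υ'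
  switching (sign-switch ζ Υ)   = signSwitch-switching ζ Υ
  switching (gain-switch θ Υ)   = gainSwitch-switching θ Υ
  switching (reorientation ρ Υ) = reorient-switching ρ Υ

  module _ {n m} {Υ Υ' : GSG R n m} {S : Subset m} where

    hyperbalanced-reflect : WF R Υ → Switching Υ Υ' → Hyperbalanced R Υ' S → Hyperbalanced R Υ S
    hyperbalanced-reflect wf sw (loose' , circle' , cc' , hc' , hh') =
      neutral-loose , neutral-circle , neutral-cc , neutral-hc , neutral-hh
      where
      open Switching sw

      neutral-loose : ∀ e → e ∈ S → ends Υ e ≡ loose → φ Υ e ≈ 0#
      neutral-loose e e∈S is-loose =
        neutral-reflect (κ e) (proj₂ (switchedAt e is-loose)) (loose' e e∈S (≡.trans (same-ends e) is-loose))

      neutral-circle : ∀ u (C : Walk R Υ u u) → IsCircle R S C → sgn R C ≡ Sign.+ → gain R C ≈ 0#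
      neutral-circle u C circle positive = neutral-reflect (α u) (gain-retarget-closed wf C positive)
        (circle' u (retarget C) (isCircle-retarget circle) (≡.trans (sgn-retarget-closed C) positive))

      neutral-cc : ∀ u w (C₁ : Walk R Υ u u) (C₂ : Walk R Υ w w) (P : Walk R Υ u w) →
                   CCHandcuff R Υ S C₁ C₂ P → gain R (handcuff C₁ P C₂) ≈ 0#
      neutral-cc u w C₁ C₂ P cc@(_ , negative₁ , _ , negative₂ , _) =
        neutral-reflect (α u) (gain-retarget-closed wf (handcuff C₁ P C₂) (sgn-handcuff C₁ P C₂ negative₁ negative₂))
          (subst (λ W → gain R W ≈ 0#) (≡.sym (retarget-handcuff C₁ P C₂))
                 (cc' u w _ _ _ (ccHandcuff-retarget sgn-retarget-closed cc)))

      neutral-hc : ∀ u w h (C₂ : Walk R Υ w w) (P : Walk R Υ u w) →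
                   HCHandcuff R Υ S h C₂ P → ultrawalkGain h (lollipop P C₂) h ≈ 0#
      neutral-hc u w h C₂ P hc@(_ , half-h , _) =
        neutral-reflect (α u) (ultrawalkGain-retarget wf half-h half-h (lollipop P C₂))
          (subst (λ W → ultrawalkGain h W h ≈ 0#) (≡.sym (retarget-lollipop P C₂))
                 (hc' u w h _ _ (hcHandcuff-retarget sgn-retarget-closed hc)))

      neutral-hh : ∀ u w h₁ h₂ (P : Walk R Υ u w) → HHHandcuff R Υ S h₁ h₂ P → ultrawalkGain h₁ P h₂ ≈ 0#
      neutral-hh u w h₁ h₂ P hh@(_ , _ , _ , half₁ , half₂ , _) =
        neutral-reflect (α u) (ultrawalkGain-retarget wf half₁ half₂ P) (hh' u w h₁ h₂ _ (hhHandcuff-retarget hh))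

    balancedAt-reflect : Switching Υ Υ' → ∀ {v} → BalancedAt R Υ' S v → BalancedAt R Υ S v
    balancedAt-reflect sw balanced' x conn with balanced' x (Switching.conn-retarget sw conn)
    ... | no-half , positive =
      (λ h h∈S at-x → no-half h h∈S (≡.trans (same-ends h) at-x)) ,
      (λ C circle → ≡.trans (≡.sym (sgn-retarget-closed C)) (positive (retarget C) (isCircle-retarget circle)))
      where open Switching sw

  bCount-switch : ∀ {n m} {Υ Υ' : GSG R n m} {S k} → Switching Υ Υ' → BCount R Υ S k → BCount R Υ' S k
  bCount-switch sw (L , length≡ , balanced , apart , covering) =
    L , length≡ ,
    All.map (balancedAt-reflect (switching-sym sw)) balanced ,
    AllPairs.map (λ ¬conn conn' → ¬conn (Switching.conn-retarget (switching-sym sw) conn')) apart ,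
    λ v balanced' → Any.map (Switching.conn-retarget sw) (covering v (balancedAt-reflect sw balanced'))

  isRank-switch : ∀ {n m} {Υ Υ' : GSG R n m} {S r} → WF R Υ → Switching Υ Υ' → IsRank R Υ S r → IsRank R Υ' S r
  isRank-switch wf sw (k , count , inj₁ (hyperbalanced , r≡)) =
    k , bCount-switch sw count , inj₁ (hyperbalanced-reflect (wf-switch sw wf) (switching-sym sw) hyperbalanced , r≡)
  isRank-switch wf sw (k , count , inj₂ (¬hyperbalanced , r≡)) =
    k , bCount-switch sw count , inj₂ (¬hyperbalanced ∘ hyperbalanced-reflect wf sw , r≡)

  indicator : ∀ {n} → Fin n → Fin n → K → K
  indicator a i x = if does (a ≟ i) then x else 0#

  indicator-switch : ∀ {n} (α : Fin n → Sign) a i k t →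
                     indicator a i ⟪ α a · (k · t) ⟫ ≈ ⟪ α i ⟫ * (⟪ k ⟫ * indicator a i ⟪ t ⟫)
  indicator-switch α a i k t with a ≟ i
  ... | yes refl = ≈-trans (⟪⟫-homo (α a) (k · t)) (*-congˡ (⟪⟫-homo k t))
  ... | no _     = ≈-sym (≈-trans (*-congˡ (zeroʳ _)) (zeroʳ _))

  sumF≡sum : ∀ {k} (f : Fin k → K) → sumF R f ≡ sum f
  sumF≡sum {zero}  f = refl
  sumF≡sum {suc k} f = cong (λ s → f zero + s) (sumF≡sum (f ∘ suc))

  ∑-indicator : ∀ {n} (f : Fin n → K) a x → sum (λ i → f i * indicator a i x) ≈ f a * x
  ∑-indicator {suc n} f zero    x = begin
    f zero * x + sum (λ i → f (suc i) * 0#)  ≈⟨ +-congˡ (≈-trans (sum-cong-≋ (zeroʳ ∘ f ∘ suc)) (sum-replicate-zero n)) ⟩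
    f zero * x + 0#                          ≈⟨ +-identityʳ _ ⟩
    f zero * x                               ∎
    where open ≈-Reasoning
  ∑-indicator {suc n} f (suc a) x = ≈-trans (+-cong (zeroʳ _) (∑-indicator (f ∘ suc) a x)) (+-identityˡ _)

  module _ {n m} {Υ : GSG R n m} {e : Fin m} where

    z-link : ∀ {a b} i → ends Υ e ≡ link a b →
             z R Υ e (suc i) ≡ indicator a i ⟪ τ₁ Υ e ⟫ + indicator b i ⟪ τ₂ Υ e ⟫
    z-link i p with ends Υ e
    z-link i refl | .(link _ _) = refl

    z-half : ∀ {a} i → ends Υ e ≡ half a → z R Υ e (suc i) ≡ indicator a i ⟪ τ₁ Υ e ⟫
    z-half i p with ends Υ e
    z-half i refl | .(half _) = refl

    z-loose : ∀ i → ends Υ e ≡ loose → z R Υ e (suc i) ≡ 0#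
    z-loose i p with ends Υ e
    z-loose i refl | .loose = refl

    incidence-link : ∀ {a b} (f : Fin n → K) → ends Υ e ≡ link a b →
                     sumF R (λ j → f j * z R Υ e (suc j)) ≈ f a * ⟪ τ₁ Υ e ⟫ + f b * ⟪ τ₂ Υ e ⟫
    incidence-link {a} {b} f p = begin
      sumF R (λ j → f j * z R Υ e (suc j))
        ≡⟨ sumF≡sum (λ j → f j * z R Υ e (suc j)) ⟩
      sum (λ j → f j * z R Υ e (suc j))
        ≈⟨ sum-cong-≋ (λ j → ≈-trans (*-congˡ (reflexive (z-link j p))) (distribˡ _ _ _)) ⟩
      sum (λ j → f j * indicator a j ⟪ τ₁ Υ e ⟫ + f j * indicator b j ⟪ τ₂ Υ e ⟫)
        ≈⟨ ∑-distrib-+ (λ j → f j * indicator a j ⟪ τ₁ Υ e ⟫) (λ j → f j * indicator b j ⟪ τ₂ Υ e ⟫) ⟩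
      sum (λ j → f j * indicator a j ⟪ τ₁ Υ e ⟫) + sum (λ j → f j * indicator b j ⟪ τ₂ Υ e ⟫)
        ≈⟨ +-cong (∑-indicator f a _) (∑-indicator f b _) ⟩
      f a * ⟪ τ₁ Υ e ⟫ + f b * ⟪ τ₂ Υ e ⟫ ∎
      where open ≈-Reasoning

    incidence-half : ∀ {a} (f : Fin n → K) → ends Υ e ≡ half a →
                     sumF R (λ j → f j * z R Υ e (suc j)) ≈ f a * ⟪ τ₁ Υ e ⟫
    incidence-half {a} f p = ≈-trans (reflexive (sumF≡sum (λ j → f j * z R Υ e (suc j))))
      (≈-trans (sum-cong-≋ (λ j → *-congˡ (reflexive (z-half j p)))) (∑-indicator f a _))

    incidence-loose : ∀ (f : Fin n → K) → ends Υ e ≡ loose → sumF R (λ j → f j * z R Υ e (suc j)) ≈ 0#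
    incidence-loose f p = ≈-trans (reflexive (sumF≡sum (λ j → f j * z R Υ e (suc j))))
      (≈-trans (sum-cong-≋ (λ j → ≈-trans (*-congˡ (reflexive (z-loose j p))) (zeroʳ (f j)))) (sum-replicate-zero n))

  module _ {n m} {Υ Υ' : GSG R n m} (sw : Switching Υ Υ') where
    open Switching sw

    z-switch-head : ∀ e → z R Υ' e zero ≈ ⟪ κ e ⟫ * (z R Υ e zero + sumF R (λ j → β j * z R Υ e (suc j)))
    z-switch-head e = at (ends Υ e) refl
      where
      at : ∀ x → ends Υ e ≡ x → φ Υ' e ≈ ⟪ κ e ⟫ * (φ Υ e + sumF R (λ j → β j * z R Υ e (suc j)))
      at (link a b) p = ≈-trans (proj₂ (proj₂ (proj₂ (switchedAt e p)))) (*-congˡ (≈-trans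
        (solve 5 (λ T₁ T₂ x y φ → T₁ :* x :+ φ :+ T₂ :* y := φ :+ (x :* T₁ :+ y :* T₂)) ≈-refl _ _ _ _ _)
        (+-congˡ (≈-sym (incidence-link {Υ = Υ} {e} β p)))))
      at (half a)   p = ≈-trans (proj₂ (proj₂ (switchedAt e p))) (*-congˡ (≈-trans
        (solve 3 (λ T x φ → T :* x :+ φ := φ :+ x :* T) ≈-refl _ _ _)
        (+-congˡ (≈-sym (incidence-half {Υ = Υ} {e} β p)))))
      at loose      p = ≈-trans (proj₂ (switchedAt e p)) (*-congˡ (≈-sym
        (≈-trans (+-congˡ (incidence-loose {Υ = Υ} {e} β p)) (+-identityʳ _))))

    z-switch-tail : ∀ e i → z R Υ' e (suc i) ≈ ⟪ α i ⟫ * (⟪ κ e ⟫ * z R Υ e (suc i))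
    z-switch-tail e i = at (ends Υ e) refl
      where
      open ≈-Reasoning
      scaled : K → K
      scaled x = ⟪ α i ⟫ * (⟪ κ e ⟫ * x)
      at : ∀ x → ends Υ e ≡ x → z R Υ' e (suc i) ≈ scaled (z R Υ e (suc i))
      at (link a b) p with switchedAt e p
      ... | _ , τ₁≡ , τ₂≡ , _ = begin
        z R Υ' e (suc i)
          ≡⟨ z-link {Υ = Υ'} {e} i (≡.trans (same-ends e) p) ⟩
        indicator a i ⟪ τ₁ Υ' e ⟫ + indicator b i ⟪ τ₂ Υ' e ⟫
          ≡⟨ cong₂ (λ s t → indicator a i ⟪ s ⟫ + indicator b i ⟪ t ⟫) τ₁≡ τ₂≡ ⟩
        indicator a i ⟪ α a · (κ e · τ₁ Υ e) ⟫ + indicator b i ⟪ α b · (κ e · τ₂ Υ e) ⟫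
          ≈⟨ +-cong (indicator-switch α a i (κ e) (τ₁ Υ e)) (indicator-switch α b i (κ e) (τ₂ Υ e)) ⟩
        scaled (indicator a i ⟪ τ₁ Υ e ⟫) + scaled (indicator b i ⟪ τ₂ Υ e ⟫)
          ≈⟨ ≈-sym (≈-trans (*-congˡ (distribˡ _ _ _)) (distribˡ _ _ _)) ⟩
        scaled (indicator a i ⟪ τ₁ Υ e ⟫ + indicator b i ⟪ τ₂ Υ e ⟫)
          ≡⟨ cong scaled (≡.sym (z-link {Υ = Υ} {e} i p)) ⟩
        scaled (z R Υ e (suc i)) ∎
      at (half a) p with switchedAt e p
      ... | _ , τ₁≡ , _ = begin
        z R Υ' e (suc i)                          ≡⟨ z-half {Υ = Υ'} {e} i (≡.trans (same-ends e) p) ⟩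
        indicator a i ⟪ τ₁ Υ' e ⟫                 ≡⟨ cong (λ s → indicator a i ⟪ s ⟫) τ₁≡ ⟩
        indicator a i ⟪ α a · (κ e · τ₁ Υ e) ⟫    ≈⟨ indicator-switch α a i (κ e) (τ₁ Υ e) ⟩
        scaled (indicator a i ⟪ τ₁ Υ e ⟫)         ≡⟨ cong scaled (≡.sym (z-half {Υ = Υ} {e} i p)) ⟩
        scaled (z R Υ e (suc i))                  ∎
      at loose p = begin
        z R Υ' e (suc i)          ≡⟨ z-loose {Υ = Υ'} {e} i (≡.trans (same-ends e) p) ⟩
        0#                        ≈⟨ ≈-sym (≈-trans (*-congˡ (zeroʳ _)) (zeroʳ _)) ⟩
        scaled 0#                 ≡⟨ cong scaled (≡.sym (z-loose {Υ = Υ} {e} i p)) ⟩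
        scaled (z R Υ e (suc i))  ∎

  relation-annihilates : ∀ {m k} (coeff : Fin m → K) (Z : Fin m → Fin k → K) (β : Fin k → K) →
    (∀ i → sum (λ e → coeff e * Z e i) ≈ 0#) → sum (λ e → coeff e * sum (λ j → β j * Z e j)) ≈ 0#
  relation-annihilates {m} {k} coeff Z β rows = begin
    sum (λ e → coeff e * sum (λ j → β j * Z e j))
      ≈⟨ sum-cong-≋ (λ e → *-distribˡ-sum (coeff e) (λ j → β j * Z e j)) ⟩
    sum (λ e → sum (λ j → coeff e * (β j * Z e j)))
      ≈⟨ ∑-comm (λ e j → coeff e * (β j * Z e j)) ⟩
    sum (λ j → sum (λ e → coeff e * (β j * Z e j)))
      ≈⟨ sum-cong-≋ (λ j → ≈-trans (sum-cong-≋ (λ e → x*yz≈y*xz (coeff e) (β j) (Z e j)))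
                                   (≈-sym (*-distribˡ-sum (β j) (λ e → coeff e * Z e j)))) ⟩
    sum (λ j → β j * sum (λ e → coeff e * Z e j))
      ≈⟨ sum-cong-≋ (λ j → ≈-trans (*-congˡ (rows j)) (zeroʳ (β j))) ⟩
    sum {k} (λ _ → 0#)
      ≈⟨ sum-replicate-zero k ⟩
    0# ∎
    where open ≈-Reasoning

  LinearlyDependent : ∀ {m k} → (Fin m → Fin k → K) → Subset m → Set (c ⊔ ℓ)
  LinearlyDependent {m} Z S = Σ (Fin m → K) λ coeff →
    (∀ e → e ∉ S → coeff e ≈ 0#) × (∃ λ e → ¬ (coeff e ≈ 0#)) × (∀ i → sumF R (λ e → coeff e * Z e i) ≈ 0#)

  linearlyDependent-transform : ∀ {m n} {Z Z' : Fin m → Fin (suc n) → K}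
    (α : Fin n → Sign) (β : Fin n → K) (κ : Fin m → Sign) →
    (∀ e → Z' e zero ≈ ⟪ κ e ⟫ * (Z e zero + sumF R (λ j → β j * Z e (suc j)))) →
    (∀ e i → Z' e (suc i) ≈ ⟪ α i ⟫ * (⟪ κ e ⟫ * Z e (suc i))) →
    ∀ {S} → LinearlyDependent Z S → LinearlyDependent Z' S
  linearlyDependent-transform {m} {n} {Z} {Z'} α β κ head tail (coeff , outside , (e₀ , coeff₀≉0) , rows) =
    coeff' , (λ e e∉S → ≈-trans (*-congˡ (outside e e∉S)) (zeroʳ _)) ,
    (e₀ , coeff₀≉0 ∘ neutral-reflect (κ e₀) ≈-refl) , rows'
    where
    open ≈-Reasoning
    coeff' : Fin m → K
    coeff' e = ⟪ κ e ⟫ * coeff e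

    row : ∀ i → sum (λ e → coeff e * Z e i) ≈ 0#
    row i = ≈-trans (reflexive (≡.sym (sumF≡sum (λ e → coeff e * Z e i)))) (rows i)

    B : Fin m → K
    B e = sumF R (λ j → β j * Z e (suc j))

    shift-vanishes : sum (λ e → coeff e * B e) ≈ 0#
    shift-vanishes = ≈-trans (sum-cong-≋ (λ e → *-congˡ (reflexive (sumF≡sum (λ j → β j * Z e (suc j))))))
                             (relation-annihilates coeff (λ e j → Z e (suc j)) β (row ∘ suc))

    rows' : ∀ i → sumF R (λ e → coeff' e * Z' e i) ≈ 0#
    rows' zero = begin
      sumF R (λ e → coeff' e * Z' e zero)
        ≡⟨ sumF≡sum (λ e → coeff' e * Z' e zero) ⟩
      sum (λ e → coeff' e * Z' e zero)
        ≈⟨ sum-cong-≋ (λ e → ≈-trans (*-congˡ (head e)) (⟪⟫-cancel-pair (κ e) (coeff e) _)) ⟩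
      sum (λ e → coeff e * (Z e zero + B e))
        ≈⟨ sum-cong-≋ (λ e → distribˡ (coeff e) (Z e zero) (B e)) ⟩
      sum (λ e → coeff e * Z e zero + coeff e * B e)
        ≈⟨ ∑-distrib-+ (λ e → coeff e * Z e zero) (λ e → coeff e * B e) ⟩
      sum (λ e → coeff e * Z e zero) + sum (λ e → coeff e * B e)
        ≈⟨ +-cong (row zero) shift-vanishes ⟩
      0# + 0#
        ≈⟨ +-identityʳ 0# ⟩
      0# ∎
    rows' (suc i) = begin
      sumF R (λ e → coeff' e * Z' e (suc i))
        ≡⟨ sumF≡sum (λ e → coeff' e * Z' e (suc i)) ⟩
      sum (λ e → coeff' e * Z' e (suc i))
        ≈⟨ sum-cong-≋ (λ e → ≈-trans (*-congˡ (tail e i))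
                              (≈-trans (x*yz≈y*xz _ _ _) (*-congˡ (⟪⟫-cancel-pair (κ e) (coeff e) _)))) ⟩
      sum (λ e → ⟪ α i ⟫ * (coeff e * Z e (suc i)))
        ≈⟨ ≈-sym (*-distribˡ-sum ⟪ α i ⟫ (λ e → coeff e * Z e (suc i))) ⟩
      ⟪ α i ⟫ * sum (λ e → coeff e * Z e (suc i))
        ≈⟨ *-congˡ (row (suc i)) ⟩
      ⟪ α i ⟫ * 0#
        ≈⟨ zeroʳ _ ⟩
      0# ∎

  linDep-switch : ∀ {n m} {Υ Υ' : GSG R n m} {S} → Switching Υ Υ' → LinDep R Υ S → LinDep R Υ' S
  linDep-switch sw = linearlyDependent-transform α β κ (z-switch-head sw) (z-switch-tail sw)
    where open Switching sw

  switching-invariant : ∀ {n m} {Υ Υ' : GSG R n m} → WF R Υ → _⟶*_ R Υ Υ' →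
    (∀ S r → IsRank R Υ S r ⇔ IsRank R Υ' S r) × (∀ S → LinDep R Υ S ⇔ LinDep R Υ' S)
  switching-invariant wf ε = (λ S r → ⇔-id _) , (λ S → ⇔-id _)
  switching-invariant wf (_◅_ {j = Υ₁} step steps) with switching-invariant (wf-switch (switching step) wf) steps
  ... | sameRank , sameDep =
    (λ S r → sameRank S r ⇔-∘ mk⇔ (isRank-switch wf sw) (isRank-switch (wf-switch sw wf) (switching-sym sw))) ,
    (λ S → sameDep S ⇔-∘ mk⇔ (linDep-switch sw) (linDep-switch (switching-sym sw)))
    where
    sw : Switching _ Υ₁
    sw = switching step

corollary7p4 : ∀ {c ℓ} (R : CommutativeRing c ℓ) → IsField R → CharNot2 R →
    ∀ {n m : ℕ} (Υ Υ' : GSG R n m) → WF R Υ → _⟶*_ R Υ Υ' →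
    SameMatroid R Υ Υ' × (∀ (S : Subset m) → LinDep R Υ S ⇔ LinDep R Υ' S)
corollary7p4 R _ _ Υ Υ' wf steps with switching-invariant R wf steps
... | sameRank , sameDep =
  (λ S r → Equivalence.to (sameRank S r) , Equivalence.from (sameRank S r)) , sameDep
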